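{- Let $n\ge2$ and $1<r\le n$. Among all trees $P$ with $n$ elements and rank $r$, the tree $H_{n,r}$ is the unique (up to isomorphism) maximizer of $\sum_{u\in P}h_u$. Consequently, for every such tree $P$, $$\sum_{k=1}^nk-\sum_{u\in P}h_u\ \ge\ \sum_{k=1}^nk-\sum_{v\in H_{n,r}}h_v=\binom{n-r+1}{2}.$$
   Context: A finite poset is a forest if every element is covered by at most one element; a tree is a forest with a unique maximal element (the root). The hook length of $x\in P$ is $h_x=\#\{t\in P:t\le_Px\}$. The rank of $P$ is the maximum number of elements in a chain. $H_{n,r}$ is the tree obtained from a chain $c_1<c_2<\cdots<c_r$ (with $c_r$ the root) by adding $n-r$ further elements, each covered by $c_2$ (and incomparable to each other). -}

module Defs where

open import Data.Nat as ℕ using (ℕ; zero; suc; _+_; _∸_)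
import Data.Nat.Properties as ℕP
open import Data.Fin using (Fin; toℕ; _≟_)
open import Data.List using (List; []; _∷_; length; filter; map; upTo; allFin)
open import Data.Nat.ListAction using (sum)
open import Data.List.Relation.Unary.Linked using (Linked)
open import Data.Product using (Σ; _×_; _,_; proj₁; proj₂)
open import Data.Sum using (_⊎_; inj₁; inj₂)
open import Data.Empty using (⊥-elim)
open import Relation.Nullary using (¬_; Dec; yes; no)
open import Relation.Binary.PropositionalEquality using (_≡_; _≢_; refl; sym; trans; subst; isEquivalence)
open import Relation.Binary.Structures using (IsPartialOrder; IsPreorder)
open import Function.Bundles using (_↔_; _⇔_; Inverse)
open import Relation.Nullary.Decidable using (_⊎-dec_)

record FinPoset (n : ℕ) : Set₁ where
  field
    _≤_ : Fin n → Fin n → Set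
    _≤?_ : ∀ x y → Dec (x ≤ y)
    isPartialOrder : IsPartialOrder _≡_ _≤_

module _ {n : ℕ} (P : FinPoset n) where
  open FinPoset P

  _<ₚ_ : Fin n → Fin n → Set
  x <ₚ y = x ≤ y × x ≢ y

  Covers : Fin n → Fin n → Set
  Covers x y = x <ₚ y × (∀ z → ¬ (x <ₚ z × z <ₚ y))

  Maximal : Fin n → Set
  Maximal m = ∀ y → m ≤ y → y ≡ m

  IsForest : Set
  IsForest = ∀ x y z → Covers x y → Covers x z → y ≡ z

  IsTree : Set
  IsTree = IsForest × Σ (Fin n) (λ root → Maximal root × (∀ m → Maximal m → m ≡ root))

  IsChain : List (Fin n) → Set
  IsChain xs = Linked _<ₚ_ xs

  HasRank : ℕ → Set
  HasRank r = Σ (List (Fin n)) (λ c → IsChain c × length c ≡ r)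
            × (∀ c → IsChain c → length c ℕ.≤ r)

  hook : Fin n → ℕ
  hook x = length (filter (λ t → t ≤? x) (allFin n))

  hookSum : ℕ
  hookSum = sum (map hook (allFin n))

_≅_ : {n : ℕ} → FinPoset n → FinPoset n → Set
_≅_ {n} P Q = Σ (Fin n ↔ Fin n) λ e →
  ∀ x y → (FinPoset._≤_ P x y ⇔ FinPoset._≤_ Q (Inverse.to e x) (Inverse.to e y))

sumTo : ℕ → ℕ
sumTo n = sum (map suc (upTo n))

-- H_{n,r} on Fin n: element i with toℕ i < r is the chain element c_{i+1};
-- elements with toℕ i ≥ r are the extra elements, placed at level 0 (like c_1),
-- so they are covered exactly by c_2.
module _ (n r : ℕ) where
  lvl : Fin n → ℕ
  lvl i with toℕ i ℕ.<? r
  ... | yes _ = toℕ i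
  ... | no _ = 0

  _≤H_ : Fin n → Fin n → Set
  x ≤H y = x ≡ y ⊎ lvl x ℕ.< lvl y

  private
    refl' : ∀ {x y} → x ≡ y → x ≤H y
    refl' e = inj₁ e

    trans' : ∀ {x y z} → x ≤H y → y ≤H z → x ≤H z
    trans' (inj₁ refl) q = q
    trans' (inj₂ p) (inj₁ refl) = inj₂ p
    trans' (inj₂ p) (inj₂ q) = inj₂ (ℕP.<-trans p q)

    antisym' : ∀ {x y} → x ≤H y → y ≤H x → x ≡ y
    antisym' (inj₁ e) _ = e
    antisym' (inj₂ p) (inj₁ e) = sym e
    antisym' (inj₂ p) (inj₂ q) = ⊥-elim (ℕP.<-asym p q)

  H : FinPoset n
  H = record
    { _≤_ = _≤H_
    ; _≤?_ = λ x y → (x ≟ y) ⊎-dec (lvl x ℕ.<? lvl y)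
    ; isPartialOrder = record
      { isPreorder = record
        { isEquivalence = isEquivalence
        ; reflexive = refl'
        ; trans = trans' }
      ; antisym = antisym' }
    }

-- Count a hook sum the other way round: ∑ₓ hₓ = ∑ₜ depth t, where depth t is
-- the number of elements above t.  In a forest P of rank r every depth is at
-- most r, and the elements of a longest chain c₁ < ⋯ < c_r have depths at most
-- r, r − 1, …, 1.  Matching c_i with the i-th chain element of H_{n,r} and the
-- other elements arbitrarily, every depth of P is bounded by the corresponding
-- depth of H_{n,r}, whose depths are exactly these bounds.  If the sums agree,
-- all the bounds are attained, and a bijection preserving depths into a forest
-- is forced to be an order isomorphism: every element of depth d ≥ 2 has a
-- unique parent, of depth d − 1, and H_{n,r} has a single element of each
-- depth less than r.
module Submission where

open import Defs
open import Data.Nat using (ℕ; _≤_; _<_; _+_; _∸_)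
open import Data.Nat.Combinatorics using (_C_)
open import Data.Product using (_×_)
open import Relation.Binary.PropositionalEquality using (_≡_)

open import Level using (Level)
open import Data.Nat as ℕ using (zero; suc; pred; z≤n; s≤s; _≤′_; ≤′-refl; ≤′-step)
import Data.Nat.Properties as ℕP
open import Data.Nat.Solver using (module +-*-Solver)
open import Data.Nat.Combinatorics using (nC1≡n; nCk+nC[k+1]≡[n+1]C[k+1])
open import Data.Nat.ListAction using (sum)
open import Data.Fin as F using (Fin; toℕ; fromℕ; fromℕ<; inject₁; inject≤; lower₁)
  renaming (zero to fzero; suc to fsuc)
import Data.Fin.Properties as FP
open import Data.Fin.Induction using (po-wellFounded; po-noetherian)
open import Data.Fin.Permutation as Perm using (Permutation; _⟨$⟩ʳ_; _⟨$⟩ˡ_; _∘ₚ_; transpose)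
import Data.Fin.Permutation.Components as PC
open import Data.List using (List; []; _∷_; length; filter; map; tabulate; applyUpTo; lookup)
open import Data.List.Properties using (length-tabulate)
open import Data.List.Relation.Unary.Linked using ([]; [-]; _∷_)
open import Data.List.Relation.Unary.Linked.Properties using (AllPairs⇒Linked)
open import Data.List.Relation.Unary.AllPairs.Properties using (tabulate⁺-<)
open import Data.Product using (Σ-syntax; _,_; proj₁; proj₂)
open import Data.Sum using (inj₁; inj₂)
open import Data.Empty using (⊥-elim)
open import Function using (_∘_; flip; mk⇔)
open import Induction.WellFounded using (Acc; acc)
open import Relation.Nullary using (¬_; Dec; yes; no)
open import Relation.Nullary.Decidable using (_×-dec_; ¬?; dec-true; dec-false)
open import Relation.Unary using (Pred; Decidable)
open import Relation.Binary.Definitions using (tri<; tri≈; tri>)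
open import Relation.Binary.PropositionalEquality
  using (refl; sym; trans; cong; cong₂; subst; subst₂; _≢_; module ≡-Reasoning)
open import Relation.Binary.Structures using (IsPartialOrder)
open import Algebra.Properties.CommutativeMonoid.Sum ℕP.+-0-commutativeMonoid
  using (sum-syntax; sum-cong-≗; sum-replicate-zero; sum-init-last; ∑-distrib-+; ∑-comm; sum-permute)
  renaming (sum to ∑)

private variable
  ℓ ℓ′ ℓ″ : Level
  A : Set ℓ
  B : Set ℓ′

m∸n≡1+[m∸o]⇒o≡1+n : ∀ {m n o} → n < m → o ≤ m → m ∸ n ≡ suc (m ∸ o) → o ≡ suc n
m∸n≡1+[m∸o]⇒o≡1+n {m} {n} {o} n<m o≤m eq = sym (ℕP.∸-cancelˡ-≡ n<m o≤m (ℕP.suc-injective (begin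
  suc (m ∸ suc n) ≡⟨ ℕP.+-∸-assoc 1 n<m ⟨
  m ∸ n           ≡⟨ eq ⟩
  suc (m ∸ o)     ∎)))
  where open ≡-Reasoning

m∸n<m∸o⇒o<n : ∀ {m n o} → m ∸ n < m ∸ o → o < n
m∸n<m∸o⇒o<n {m} lt = ℕP.≰⇒> (λ n≤o → ℕP.<⇒≱ lt (ℕP.∸-monoʳ-≤ m n≤o))

-- Indicators and finite sums

χ : Dec A → ℕ
χ (yes _) = 1
χ (no _)  = 0

χ-mono : (A? : Dec A) (B? : Dec B) → (A → B) → χ A? ≤ χ B?
χ-mono (yes _) (yes _) _ = ℕP.≤-refl
χ-mono (yes x) (no ¬y) f = ⊥-elim (¬y (f x))
χ-mono (no _)  _       _ = z≤n

χ-cong : (A? : Dec A) (B? : Dec B) → (A → B) → (B → A) → χ A? ≡ χ B?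
χ-cong A? B? f g = ℕP.≤-antisym (χ-mono A? B? f) (χ-mono B? A? g)

χ-yes : (A? : Dec A) → A → χ A? ≡ 1
χ-yes (yes _) _ = refl
χ-yes (no ¬x) x = ⊥-elim (¬x x)

χ-no : (A? : Dec A) → ¬ A → χ A? ≡ 0
χ-no (yes x) ¬x = ⊥-elim (¬x x)
χ-no (no _)  _  = refl

∑-mono-≤ : ∀ {n} {f g : Fin n → ℕ} → (∀ i → f i ≤ g i) → ∑ f ≤ ∑ g
∑-mono-≤ {zero}  _   = z≤n
∑-mono-≤ {suc n} f≤g = ℕP.+-mono-≤ (f≤g fzero) (∑-mono-≤ (f≤g ∘ fsuc))

∑-mono-< : ∀ {n} {f g : Fin n → ℕ} → (∀ i → f i ≤ g i) → ∀ j → f j < g j → ∑ f < ∑ g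
∑-mono-< f≤g fzero    fj<gj = ℕP.+-mono-<-≤ fj<gj (∑-mono-≤ (f≤g ∘ fsuc))
∑-mono-< f≤g (fsuc j) fj<gj = ℕP.+-mono-≤-< (f≤g fzero) (∑-mono-< (f≤g ∘ fsuc) j fj<gj)

∑-≡⇒≗ : ∀ {n} {f g : Fin n → ℕ} → (∀ i → f i ≤ g i) → ∑ f ≡ ∑ g → ∀ i → f i ≡ g i
∑-≡⇒≗ f≤g ∑f≡∑g i = ℕP.≤∧≮⇒≡ (f≤g i) (λ fi<gi → ℕP.<-irrefl ∑f≡∑g (∑-mono-< f≤g i fi<gi))

∑-χ-≟ : ∀ {n} (t : Fin n) → ∑[ z < n ] χ (z F.≟ t) ≡ 1
∑-χ-≟ {suc n} fzero = cong suc (trans (sum-cong-≗ {n} (λ i → χ-no (fsuc i F.≟ fzero) (λ ())))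
                                      (sum-replicate-zero n))
∑-χ-≟ {suc n} (fsuc t) = begin
  χ (fzero F.≟ fsuc t) + ∑[ i < n ] χ (fsuc i F.≟ fsuc t) ≡⟨ cong₂ _+_ (χ-no (fzero F.≟ fsuc t) (λ ()))
                                                              (sum-cong-≗ {n} same) ⟩
  ∑[ i < n ] χ (i F.≟ t)                                  ≡⟨ ∑-χ-≟ t ⟩
  1                                                       ∎
  where
  open ≡-Reasoning
  same : ∀ i → χ (fsuc i F.≟ fsuc t) ≡ χ (i F.≟ t)
  same i = χ-cong (fsuc i F.≟ fsuc t) (i F.≟ t) FP.suc-injective (cong fsuc)

length-filter-tabulate : ∀ {n} {P : Pred A ℓ″} (P? : Decidable P) (f : Fin n → A) →
                         length (filter P? (tabulate f)) ≡ ∑[ i < n ] χ (P? (f i))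
length-filter-tabulate {n = zero}  P? f = refl
length-filter-tabulate {n = suc n} P? f with P? (f fzero)
... | yes _ = cong suc (length-filter-tabulate P? (f ∘ fsuc))
... | no _  = length-filter-tabulate P? (f ∘ fsuc)

sum-map-tabulate : ∀ {n} (g : A → ℕ) (f : Fin n → A) → sum (map g (tabulate f)) ≡ ∑[ i < n ] g (f i)
sum-map-tabulate {n = zero}  g f = refl
sum-map-tabulate {n = suc n} g f = cong (g (f fzero) +_) (sum-map-tabulate g (f ∘ fsuc))

sum-map-applyUpTo : ∀ n (g f : ℕ → ℕ) → sum (map g (applyUpTo f n)) ≡ ∑[ i < n ] g (f (toℕ i))
sum-map-applyUpTo zero    g f = refl
sum-map-applyUpTo (suc n) g f = cong (g (f 0) +_) (sum-map-applyUpTo n g (f ∘ suc))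

sumTo-suc : ∀ m → sumTo (suc m) ≡ sumTo m + suc m
sumTo-suc m = begin
  sumTo (suc m)                                                ≡⟨ sum-map-applyUpTo (suc m) suc (λ k → k) ⟩
  ∑[ i < suc m ] suc (toℕ i)                                   ≡⟨ sum-init-last (suc ∘ toℕ) ⟩
  ∑[ i < m ] suc (toℕ (inject₁ i)) + suc (toℕ (fromℕ m))       ≡⟨ cong₂ _+_ (sum-cong-≗ {m} (cong suc ∘ FP.toℕ-inject₁))
                                                                            (cong suc (FP.toℕ-fromℕ m)) ⟩
  ∑[ i < m ] suc (toℕ i) + suc m                               ≡⟨ cong (_+ suc m) (sum-map-applyUpTo m suc (λ k → k)) ⟨
  sumTo m + suc m                                              ∎
  where open ≡-Reasoning

∑-reverse : ∀ m → ∑[ i < m ] (m ∸ toℕ i) ≡ sumTo m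
∑-reverse zero    = refl
∑-reverse (suc m) = begin
  suc m + ∑[ i < m ] (m ∸ toℕ i) ≡⟨ cong (suc m +_) (∑-reverse m) ⟩
  suc m + sumTo m                ≡⟨ ℕP.+-comm (suc m) (sumTo m) ⟩
  sumTo m + suc m                ≡⟨ sumTo-suc m ⟨
  sumTo (suc m)                  ∎
  where open ≡-Reasoning

-- Permutations

transpose-matchˡ : ∀ {n} (u v : Fin n) → PC.transpose u v u ≡ v
transpose-matchˡ u v rewrite dec-true (u F.≟ u) refl = refl

transpose-fixes : ∀ {n} (u v k : Fin n) → k ≢ u → k ≢ v → PC.transpose u v k ≡ k
transpose-fixes u v k k≢u k≢v rewrite dec-false (k F.≟ u) k≢u | dec-false (k F.≟ v) k≢v = refl

permutation-injective : ∀ {n} (π : Permutation n n) {i j} → π ⟨$⟩ʳ i ≡ π ⟨$⟩ʳ j → i ≡ j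
permutation-injective π {i} {j} eq =
  trans (sym (Perm.inverseˡ π)) (trans (cong (π ⟨$⟩ˡ_) eq) (Perm.inverseˡ π))

extend-injection : ∀ {m n} (g : Fin m → Fin n) → (∀ {i j} → g i ≡ g j → i ≡ j) → (m≤n : m ≤ n) →
                   Σ[ π ∈ Permutation n n ] (∀ i → π ⟨$⟩ʳ inject≤ i m≤n ≡ g i)
extend-injection {zero}  g _     _   = Perm.id , λ ()
extend-injection {suc m} g g-inj m<n = π ∘ₚ transpose u v , agrees
  where
  m≤n = ℕP.<⇒≤ m<n
  prefix = extend-injection (g ∘ inject₁) (FP.inject₁-injective ∘ g-inj) m≤n
  π = proj₁ prefix
  u = π ⟨$⟩ʳ inject≤ (fromℕ m) m<n
  v = g (fromℕ m)

  agrees : ∀ i → PC.transpose u v (π ⟨$⟩ʳ inject≤ i m<n) ≡ g i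
  agrees i with m ℕP.≟ toℕ i
  ... | yes m≡i rewrite FP.toℕ-injective {i = i} {j = fromℕ m} (trans (sym m≡i) (sym (FP.toℕ-fromℕ m)))
    = transpose-matchˡ u v
  ... | no m≢i = trans (cong (PC.transpose u v) πi≡gi) (transpose-fixes u v (g i) gi≢u gi≢v)
    where
    i′ = lower₁ i m≢i
    i′≡i : inject₁ i′ ≡ i
    i′≡i = FP.inject₁-lower₁ i m≢i
    same-position : inject≤ i m<n ≡ inject≤ i′ m≤n
    same-position = FP.toℕ-injective (begin
      toℕ (inject≤ i m<n)  ≡⟨ FP.toℕ-inject≤ i m<n ⟩
      toℕ i                ≡⟨ cong toℕ i′≡i ⟨
      toℕ (inject₁ i′)     ≡⟨ FP.toℕ-inject₁ i′ ⟩
      toℕ i′               ≡⟨ FP.toℕ-inject≤ i′ m≤n ⟨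
      toℕ (inject≤ i′ m≤n) ∎)
      where open ≡-Reasoning
    πi≡gi : π ⟨$⟩ʳ inject≤ i m<n ≡ g i
    πi≡gi = trans (cong (π ⟨$⟩ʳ_) same-position) (trans (proj₂ prefix i′) (cong g i′≡i))
    i≢last : i ≢ fromℕ m
    i≢last i≡m = m≢i (trans (sym (FP.toℕ-fromℕ m)) (cong toℕ (sym i≡m)))
    gi≢u : g i ≢ u
    gi≢u gi≡u = i≢last (FP.inject≤-injective m<n m<n i (fromℕ m)
                          (permutation-injective π (trans πi≡gi gi≡u)))
    gi≢v : g i ≢ v
    gi≢v = i≢last ∘ g-inj

≅-fromPermutation : ∀ {n} {P Q : FinPoset n} (σ : Permutation n n) →
                    (∀ {a b} → FinPoset._≤_ Q a b → FinPoset._≤_ P (σ ⟨$⟩ʳ a) (σ ⟨$⟩ʳ b)) →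
                    (∀ {a b} → FinPoset._≤_ P (σ ⟨$⟩ʳ a) (σ ⟨$⟩ʳ b) → FinPoset._≤_ Q a b) →
                    P ≅ Q
≅-fromPermutation {P = P} σ σ-mono σ-reflects =
  Perm.flip σ , λ x y → mk⇔ (λ x⊑y → σ-reflects (subst₂ _⊑_ (sym inv) (sym inv) x⊑y))
                            (λ σx⊑σy → subst₂ _⊑_ inv inv (σ-mono σx⊑σy))
  where
  open FinPoset P renaming (_≤_ to _⊑_)
  inv : ∀ {x} → σ ⟨$⟩ʳ (σ ⟨$⟩ˡ x) ≡ x
  inv = Perm.inverseʳ σ

-- Depth in a finite poset

module Depth {n : ℕ} (P : FinPoset n) where
  open FinPoset P renaming (_≤_ to _⊑_; _≤?_ to _⊑?_)
  open IsPartialOrder isPartialOrder using (antisym)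
    renaming (reflexive to ⊑-reflexive; trans to ⊑-trans)

  _⊏_ : Fin n → Fin n → Set
  _⊏_ = _<ₚ_ P

  _⊏?_ : ∀ x y → Dec (x ⊏ y)
  x ⊏? y = (x ⊑? y) ×-dec ¬? (x F.≟ y)

  ⊑-refl : ∀ {x} → x ⊑ x
  ⊑-refl = ⊑-reflexive refl

  ⊏⇒⋣ : ∀ {x y} → x ⊏ y → ¬ (y ⊑ x)
  ⊏⇒⋣ (x⊑y , x≢y) y⊑x = x≢y (antisym x⊑y y⊑x)

  ⊏-trans : ∀ {x y z} → x ⊏ y → y ⊏ z → x ⊏ z
  ⊏-trans x⊏y y⊏z = ⊑-trans (proj₁ x⊏y) (proj₁ y⊏z) , λ { refl → ⊏⇒⋣ x⊏y (proj₁ y⊏z) }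

  depth : Fin n → ℕ
  depth t = ∑[ z < n ] χ (t ⊑? z)

  hookSum≡∑depth : hookSum P ≡ ∑ depth
  hookSum≡∑depth = begin
    hookSum P                          ≡⟨ sum-map-tabulate (hook P) (λ x → x) ⟩
    ∑[ x < n ] hook P x                ≡⟨ sum-cong-≗ (λ x → length-filter-tabulate (_⊑? x) (λ t → t)) ⟩
    ∑[ x < n ] ∑[ t < n ] χ (t ⊑? x)   ≡⟨ ∑-comm (λ x t → χ (t ⊑? x)) ⟩
    ∑ depth                            ∎
    where open ≡-Reasoning

  depth-antitone : ∀ {x y} → x ⊏ y → depth y < depth x
  depth-antitone {x} {y} x⊏y =
    ∑-mono-< (λ z → χ-mono (y ⊑? z) (x ⊑? z) (⊑-trans (proj₁ x⊏y))) x
             (subst₂ _<_ (sym (χ-no (y ⊑? x) (⊏⇒⋣ x⊏y))) (sym (χ-yes (x ⊑? x) ⊑-refl)) ℕP.0<1+n)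

  depth-maximal : ∀ {t} → (∀ z → ¬ t ⊏ z) → depth t ≡ 1
  depth-maximal {t} t-maximal =
    trans (sum-cong-≗ (λ z → χ-cong (t ⊑? z) (z F.≟ t) (above z) (⊑-reflexive ∘ sym))) (∑-χ-≟ t)
    where
    above : ∀ z → t ⊑ z → z ≡ t
    above z t⊑z with t F.≟ z
    ... | yes t≡z = sym t≡z
    ... | no t≢z  = ⊥-elim (t-maximal z (t⊑z , t≢z))

  cover-below : ∀ {t a} → t ⊏ a → Σ[ p ∈ Fin n ] Covers P t p × p ⊑ a
  cover-below {a = a} = go (po-wellFounded isPartialOrder a)
    where
    go : ∀ {t a} → Acc _⊏_ a → t ⊏ a → Σ[ p ∈ Fin n ] Covers P t p × p ⊑ a
    go {t} {a} (acc rec) t⊏a with FP.any? (λ z → (t ⊏? z) ×-dec (z ⊏? a))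
    ... | yes (z , t⊏z , z⊏a) = let (p , t⋖p , p⊑z) = go (rec z⊏a) t⊏z in
                                p , t⋖p , ⊑-trans p⊑z (proj₁ z⊏a)
    ... | no ∄between = a , (t⊏a , λ z between → ∄between (z , between)) , ⊑-refl

  lookup-⊏ : ∀ {xs} → IsChain P xs → ∀ {i j} → i F.< j → lookup xs i ⊏ lookup xs j
  lookup-⊏ (x⊏y ∷ _)  {fzero}  {fsuc fzero}    _          = x⊏y
  lookup-⊏ (x⊏y ∷ ch) {fzero}  {fsuc (fsuc j)} _          = ⊏-trans x⊏y (lookup-⊏ ch {fzero} {fsuc j} ℕP.0<1+n)
  lookup-⊏ (_ ∷ ch)   {fsuc i} {fsuc j}        (s≤s i<j)  = lookup-⊏ ch i<j

  lookup-injective : ∀ {xs} → IsChain P xs → ∀ {i j} → lookup xs i ≡ lookup xs j → i ≡ j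
  lookup-injective ch {i} {j} eq with FP.<-cmp i j
  ... | tri< i<j _ _ = ⊥-elim (proj₂ (lookup-⊏ ch i<j) eq)
  ... | tri≈ _ i≡j _ = i≡j
  ... | tri> _ _ j<i = ⊥-elim (proj₂ (lookup-⊏ ch j<i) (sym eq))

  depth-lookup-head : ∀ {x xs} → IsChain P (x ∷ xs) → ∀ i → depth (lookup (x ∷ xs) i) + toℕ i ≤ depth x
  depth-lookup-head _ fzero = ℕP.≤-reflexive (ℕP.+-identityʳ _)
  depth-lookup-head {x} {y ∷ ys} (x⊏y ∷ ch) (fsuc i) = begin
    depth (lookup (y ∷ ys) i) + suc (toℕ i) ≡⟨ ℕP.+-suc _ (toℕ i) ⟩
    suc (depth (lookup (y ∷ ys) i) + toℕ i) ≤⟨ s≤s (depth-lookup-head ch i) ⟩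
    suc (depth y)                           ≤⟨ depth-antitone x⊏y ⟩
    depth x                                 ∎
    where open ℕP.≤-Reasoning

  depth-lookup : ∀ {r xs} → IsChain P xs → (∀ t → depth t ≤ r) → ∀ i → depth (lookup xs i) + toℕ i ≤ r
  depth-lookup {xs = x ∷ xs} ch depth≤r i = ℕP.≤-trans (depth-lookup-head ch i) (depth≤r x)

  module _ (forest : IsForest P) where

    depth-cover : ∀ {t p} → Covers P t p → depth t ≡ suc (depth p)
    depth-cover {t} {p} t⋖p = begin
      depth t                                   ≡⟨ sum-cong-≗ split ⟩
      ∑[ z < n ] (χ (z F.≟ t) + χ (p ⊑? z))    ≡⟨ ∑-distrib-+ (λ z → χ (z F.≟ t)) (λ z → χ (p ⊑? z)) ⟩
      ∑[ z < n ] χ (z F.≟ t) + depth p          ≡⟨ cong (_+ depth p) (∑-χ-≟ t) ⟩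
      suc (depth p)                             ∎
      where
      open ≡-Reasoning
      split : ∀ z → χ (t ⊑? z) ≡ χ (z F.≟ t) + χ (p ⊑? z)
      split z with z F.≟ t
      ... | yes refl = trans (χ-yes (t ⊑? t) ⊑-refl) (cong suc (sym (χ-no (p ⊑? t) (⊏⇒⋣ (proj₁ t⋖p)))))
      ... | no z≢t   = χ-cong (t ⊑? z) (p ⊑? z) via-parent (⊑-trans (proj₁ (proj₁ t⋖p)))
        where
        -- Any strict upper bound of t lies above some cover of t, and that cover is p.
        via-parent : t ⊑ z → p ⊑ z
        via-parent t⊑z = let (q , t⋖q , q⊑z) = cover-below (t⊑z , z≢t ∘ sym) in
                         subst (_⊑ z) (forest t q p t⋖q t⋖p) q⊑z

    upward-chain : ∀ t → Σ[ c ∈ List (Fin n) ] IsChain P (t ∷ c) × suc (length c) ≡ depth t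
    upward-chain t = go t (po-noetherian isPartialOrder t)
      where
      go : ∀ t → Acc (flip _⊏_) t → Σ[ c ∈ List (Fin n) ] IsChain P (t ∷ c) × suc (length c) ≡ depth t
      go t (acc rec) with FP.any? (t ⊏?_)
      ... | no ∄above = [] , [-] , sym (depth-maximal (λ z t⊏z → ∄above (z , t⊏z)))
      ... | yes (_ , t⊏z) = let (p , t⋖p , _) = cover-below t⊏z
                                (c , chain , length≡depth) = go p (rec (proj₁ t⋖p)) in
                            p ∷ c , proj₁ t⋖p ∷ chain , trans (cong suc length≡depth) (sym (depth-cover t⋖p))

    depth≤rank : ∀ {r} → HasRank P r → ∀ t → depth t ≤ r
    depth≤rank (_ , longest) t = let (c , chain , length≡depth) = upward-chain t in
                                 subst (_≤ _) length≡depth (longest (t ∷ c) chain)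

-- The tree H_{n,r}

lvl-below : ∀ {n r} (a : Fin n) → toℕ a < r → lvl n r a ≡ toℕ a
lvl-below {r = r} a a<r with toℕ a ℕ.<? r
... | yes _  = refl
... | no a≮r = ⊥-elim (a≮r a<r)

lvl-above : ∀ {n r} (a : Fin n) → ¬ toℕ a < r → lvl n r a ≡ 0
lvl-above {r = r} a a≮r with toℕ a ℕ.<? r
... | yes a<r = ⊥-elim (a≮r a<r)
... | no _    = refl

lvl-cong : ∀ {m n r} {a : Fin m} {b : Fin n} → toℕ a ≡ toℕ b → lvl m r a ≡ lvl n r b
lvl-cong {r = r} {a} {b} a≡b with toℕ a ℕ.<? r
... | yes a<r = trans a≡b (sym (lvl-below b (subst (_< r) a≡b a<r)))
... | no a≮r  = sym (lvl-above b (a≮r ∘ subst (_< r) (sym a≡b)))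

∑-depthH+binomial : ∀ {r n} → r ≤′ n → ∑[ a < n ] (r ∸ lvl n r a) + (n ∸ r + 1) C 2 ≡ sumTo n
∑-depthH+binomial {r} ≤′-refl = begin
  ∑[ a < r ] (r ∸ lvl r r a) + (r ∸ r + 1) C 2 ≡⟨ cong₂ _+_ (sum-cong-≗ {r} (λ a → cong (r ∸_) (lvl-below a (FP.toℕ<n a))))
                                                          (cong (λ k → (k + 1) C 2) (ℕP.n∸n≡0 r)) ⟩
  ∑[ a < r ] (r ∸ toℕ a) + 0                   ≡⟨ ℕP.+-identityʳ _ ⟩
  ∑[ a < r ] (r ∸ toℕ a)                       ≡⟨ ∑-reverse r ⟩
  sumTo r                                      ∎
  where open ≡-Reasoning
∑-depthH+binomial {r} {suc n} (≤′-step r≤′n) = begin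
  ∑[ a < suc n ] (r ∸ lvl (suc n) r a) + (suc n ∸ r + 1) C 2
    ≡⟨ cong₂ _+_ (sum-init-last (λ a → r ∸ lvl (suc n) r a)) (cong (λ k → (k + 1) C 2) (ℕP.+-∸-assoc 1 r≤n)) ⟩
  ∑[ a < n ] (r ∸ lvl (suc n) r (inject₁ a)) + (r ∸ lvl (suc n) r (fromℕ n)) + suc (q + 1) C 2
    ≡⟨ cong₂ _+_ (cong₂ _+_ (sum-cong-≗ {n} (λ a → cong (r ∸_) (lvl-cong {r = r} (FP.toℕ-inject₁ a))))
                            (cong (r ∸_) (lvl-above (fromℕ n) last≮r)))
                 (sym (nCk+nC[k+1]≡[n+1]C[k+1] (q + 1) 1)) ⟩
  S + r + ((q + 1) C 1 + (q + 1) C 2)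
    ≡⟨ cong (λ k → S + r + (k + (q + 1) C 2)) (nC1≡n (q + 1)) ⟩
  S + r + (q + 1 + (q + 1) C 2)
    ≡⟨ solve 4 (λ s r q c → s :+ r :+ (q :+ c) := s :+ c :+ (r :+ q)) refl S r (q + 1) ((q + 1) C 2) ⟩
  S + (q + 1) C 2 + (r + (q + 1))
    ≡⟨ cong₂ _+_ (∑-depthH+binomial r≤′n) r+[q+1]≡1+n ⟩
  sumTo n + suc n
    ≡⟨ sumTo-suc n ⟨
  sumTo (suc n)
    ∎
  where
  open ≡-Reasoning
  open +-*-Solver
  r≤n = ℕP.≤′⇒≤ r≤′n
  q = n ∸ r
  S = ∑[ a < n ] (r ∸ lvl n r a)
  last≮r : ¬ toℕ (fromℕ n) < r
  last≮r = ℕP.≤⇒≯ (subst (r ≤_) (sym (FP.toℕ-fromℕ n)) r≤n)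
  r+[q+1]≡1+n : r + (q + 1) ≡ suc n
  r+[q+1]≡1+n = begin
    r + (q + 1) ≡⟨ ℕP.+-assoc r q 1 ⟨
    r + q + 1   ≡⟨ cong (_+ 1) (ℕP.m+[n∸m]≡n r≤n) ⟩
    n + 1       ≡⟨ ℕP.+-comm n 1 ⟩
    suc n       ∎

module HTree {n r : ℕ} (1<r : 1 < r) (r≤n : r ≤ n) where
  open Depth (H n r)

  level : Fin n → ℕ
  level = lvl n r

  0<r : 0 < r
  0<r = ℕP.<-trans ℕP.0<1+n 1<r

  level<r : ∀ a → level a < r
  level<r a with toℕ a ℕ.<? r
  ... | yes a<r = a<r
  ... | no _    = 0<r

  level≡toℕ : ∀ a → 0 < level a → level a ≡ toℕ a
  level≡toℕ a 0<ℓ with toℕ a ℕ.<? r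
  ... | yes _ = refl
  ... | no _  = ⊥-elim (ℕP.<-irrefl refl 0<ℓ)

  level-injective : ∀ {a b} → level a ≡ level b → 0 < level a → a ≡ b
  level-injective {a} {b} eq 0<ℓa =
    FP.toℕ-injective (trans (sym (level≡toℕ a 0<ℓa)) (trans eq (level≡toℕ b (subst (0 <_) eq 0<ℓa))))

  spine : Fin r → Fin n
  spine i = inject≤ i r≤n

  level-spine : ∀ i → level (spine i) ≡ toℕ i
  level-spine i = trans (lvl-below (spine i) (subst (_< r) (sym (FP.toℕ-inject≤ i r≤n)) (FP.toℕ<n i)))
                        (FP.toℕ-inject≤ i r≤n)

  at-level : ∀ k → k < r → Fin n
  at-level k k<r = spine (fromℕ< k<r)

  level-at-level : ∀ k (k<r : k < r) → level (at-level k k<r) ≡ k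
  level-at-level k k<r = trans (level-spine (fromℕ< k<r)) (FP.toℕ-fromℕ< k<r)

  ⊏⇒level< : ∀ {a b} → a ⊏ b → level a < level b
  ⊏⇒level< (inj₁ a≡b , a≢b) = ⊥-elim (a≢b a≡b)
  ⊏⇒level< (inj₂ lt  , _)   = lt

  level<⇒⊏ : ∀ {a b} → level a < level b → a ⊏ b
  level<⇒⊏ lt = inj₂ lt , λ { refl → ℕP.<-irrefl refl lt }

  covers⇒level≡1+level : ∀ {a b} → Covers (H n r) a b → level b ≡ suc (level a)
  covers⇒level≡1+level {a} {b} (a⊏b , nothing-between) with ℕP.m≤n⇒m<n∨m≡n (⊏⇒level< a⊏b)
  ... | inj₂ eq    = sym eq
  ... | inj₁ 1+a<b = ⊥-elim (nothing-between c (level<⇒⊏ a<c , level<⇒⊏ c<b))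
    where
    c = at-level (suc (level a)) (ℕP.<-trans 1+a<b (level<r b))
    ℓc = level-at-level (suc (level a)) (ℕP.<-trans 1+a<b (level<r b))
    a<c : level a < level c
    a<c = subst (level a <_) (sym ℓc) ℕP.≤-refl
    c<b : level c < level b
    c<b = subst (_< level b) (sym ℓc) 1+a<b

  level≡1+level⇒covers : ∀ {a b} → level b ≡ suc (level a) → Covers (H n r) a b
  level≡1+level⇒covers {a} {b} eq = level<⇒⊏ (subst (level a <_) (sym eq) ℕP.≤-refl) , nothing-between
    where
    nothing-between : ∀ z → ¬ (a ⊏ z × z ⊏ b)
    nothing-between z (a⊏z , z⊏b) =
      ℕP.<⇒≱ (⊏⇒level< a⊏z) (ℕP.≤-pred (subst (level z <_) eq (⊏⇒level< z⊏b)))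

  H-isForest : IsForest (H n r)
  H-isForest a b c a⋖b a⋖c = level-injective
    (trans (covers⇒level≡1+level a⋖b) (sym (covers⇒level≡1+level a⋖c)))
    (subst (0 <_) (sym (covers⇒level≡1+level a⋖b)) ℕP.0<1+n)

  pred[r]<r : pred r < r
  pred[r]<r = ℕP.m≤pred[n]⇒suc[m]≤n {{ℕ.>-nonZero 0<r}} ℕP.≤-refl

  root : Fin n
  root = at-level (pred r) pred[r]<r

  level-root : level root ≡ pred r
  level-root = level-at-level (pred r) pred[r]<r

  root-maximal : Maximal (H n r) root
  root-maximal y (inj₁ root≡y) = sym root≡y
  root-maximal y (inj₂ lt)     = ⊥-elim (ℕP.<⇒≱ (subst (_< level y) level-root lt) (ℕP.<⇒≤pred (level<r y)))

  maximal-unique : ∀ m → Maximal (H n r) m → m ≡ root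
  maximal-unique m m-maximal with ℕP.m≤n⇒m<n∨m≡n (ℕP.<⇒≤pred (level<r m))
  ... | inj₁ lt = sym (m-maximal root (inj₂ (subst (level m <_) (sym level-root) lt)))
  ... | inj₂ eq = level-injective (trans eq (sym level-root)) (subst (0 <_) (sym eq) (ℕP.<⇒≤pred 1<r))

  H-isTree : IsTree (H n r)
  H-isTree = H-isForest , root , root-maximal , maximal-unique

  length+level≤r : ∀ {x xs} → IsChain (H n r) (x ∷ xs) → length (x ∷ xs) + level x ≤ r
  length+level≤r {x} [-] = level<r x
  length+level≤r {x} {y ∷ ys} (x⊏y ∷ chain) = begin
    suc (length (y ∷ ys)) + level x ≡⟨ ℕP.+-suc (length (y ∷ ys)) (level x) ⟨
    length (y ∷ ys) + suc (level x) ≤⟨ ℕP.+-monoʳ-≤ (length (y ∷ ys)) (⊏⇒level< x⊏y) ⟩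
    length (y ∷ ys) + level y       ≤⟨ length+level≤r chain ⟩
    r                               ∎
    where open ℕP.≤-Reasoning

  H-rank : HasRank (H n r) r
  H-rank = (tabulate spine , spine-chain , length-tabulate spine) , length≤r
    where
    spine-chain : IsChain (H n r) (tabulate spine)
    spine-chain = AllPairs⇒Linked (tabulate⁺-< (λ {i} {j} i<j →
      level<⇒⊏ (subst₂ _<_ (sym (level-spine i)) (sym (level-spine j)) i<j)))
    length≤r : ∀ c → IsChain (H n r) c → length c ≤ r
    length≤r []       _     = z≤n
    length≤r (x ∷ xs) chain = ℕP.≤-trans (ℕP.m≤m+n _ (level x)) (length+level≤r chain)

  depth-H : ∀ a → depth a ≡ r ∸ level a
  depth-H a = trans (go (r ∸ suc (level a)) a (ℕP.m∸n+n≡m (level<r a))) (sym (ℕP.+-∸-assoc 1 (level<r a)))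
    where
    go : ∀ k a → k + suc (level a) ≡ r → depth a ≡ suc k
    go zero    a eq = depth-maximal λ z a⊏z → ℕP.<⇒≱ (level<r z) (subst (_≤ level z) eq (⊏⇒level< a⊏z))
    go (suc k) a eq = begin
      depth a       ≡⟨ depth-cover H-isForest (level≡1+level⇒covers ℓb) ⟩
      suc (depth b) ≡⟨ cong suc (go k b (trans (cong (λ m → k + suc m) ℓb) (trans (ℕP.+-suc k _) eq))) ⟩
      suc (suc k)   ∎
      where
      open ≡-Reasoning
      1+a<r : suc (level a) < r
      1+a<r = ℕP.≤-trans (s≤s (ℕP.m≤n+m (suc (level a)) k)) (ℕP.≤-reflexive eq)
      b = at-level (suc (level a)) 1+a<r
      ℓb = level-at-level (suc (level a)) 1+a<r

  hookSum-H : hookSum (H n r) ≡ ∑[ a < n ] (r ∸ level a)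
  hookSum-H = trans hookSum≡∑depth (sum-cong-≗ depth-H)

-- Forests of rank r compared with H_{n,r}

module Comparison {n r : ℕ} (r≤n : r ≤ n) (P : FinPoset n) (forest : IsForest P) (rank : HasRank P r) where
  open Depth P

  private
    c = proj₁ (proj₁ rank)
    c-chain = proj₁ (proj₂ (proj₁ rank))
    length-c = proj₂ (proj₂ (proj₁ rank))
    length-c≤n : length c ≤ n
    length-c≤n = subst (_≤ n) (sym length-c) r≤n
    extension = extend-injection (lookup c) (lookup-injective c-chain) length-c≤n

  σ : Permutation n n
  σ = proj₁ extension

  depth-σ≤ : ∀ a → depth (σ ⟨$⟩ʳ a) ≤ r ∸ lvl n r a
  depth-σ≤ a = bound (toℕ a ℕ.<? r)
    where
    bound : Dec (toℕ a < r) → depth (σ ⟨$⟩ʳ a) ≤ r ∸ lvl n r a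
    bound (no a≮r) = subst (λ m → depth (σ ⟨$⟩ʳ a) ≤ r ∸ m) (sym (lvl-above a a≮r))
                           (depth≤rank forest rank (σ ⟨$⟩ʳ a))
    bound (yes a<r) = begin
      depth (σ ⟨$⟩ʳ a)   ≡⟨ cong depth σa≡cj ⟩
      depth (lookup c j) ≤⟨ ℕP.m+n≤o⇒m≤o∸n _ (depth-lookup c-chain (depth≤rank forest rank) j) ⟩
      r ∸ toℕ j          ≡⟨ cong (r ∸_) (FP.toℕ-fromℕ< a<length-c) ⟩
      r ∸ toℕ a          ≡⟨ cong (r ∸_) (lvl-below a a<r) ⟨
      r ∸ lvl n r a      ∎
      where
      open ℕP.≤-Reasoning
      a<length-c = subst (toℕ a <_) (sym length-c) a<r
      j = fromℕ< a<length-c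
      σa≡cj : σ ⟨$⟩ʳ a ≡ lookup c j
      σa≡cj = trans (cong (σ ⟨$⟩ʳ_) (FP.toℕ-injective (sym (trans (FP.toℕ-inject≤ j length-c≤n)
                                                                   (FP.toℕ-fromℕ< a<length-c)))))
                    (proj₂ extension j)

  hookSum≡∑depth∘σ : hookSum P ≡ ∑[ a < n ] depth (σ ⟨$⟩ʳ a)
  hookSum≡∑depth∘σ = trans hookSum≡∑depth (sum-permute depth σ)

  hookSum≤∑depthH : hookSum P ≤ ∑[ a < n ] (r ∸ lvl n r a)
  hookSum≤∑depthH = subst (_≤ _) (sym hookSum≡∑depth∘σ) (∑-mono-≤ depth-σ≤)

  depth-σ≡ : hookSum P ≡ ∑[ a < n ] (r ∸ lvl n r a) → ∀ a → depth (σ ⟨$⟩ʳ a) ≡ r ∸ lvl n r a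
  depth-σ≡ eq = ∑-≡⇒≗ depth-σ≤ (trans (sym hookSum≡∑depth∘σ) eq)

module Rigidity {n r : ℕ} (1<r : 1 < r) (r≤n : r ≤ n) (P : FinPoset n) (forest : IsForest P)
                (σ : Permutation n n) (depth-σ : ∀ a → Depth.depth P (σ ⟨$⟩ʳ a) ≡ r ∸ lvl n r a) where
  open Depth P
  open FinPoset P using () renaming (_≤_ to _⊑_; isPartialOrder to ⊑-isPartialOrder)
  open IsPartialOrder ⊑-isPartialOrder using () renaming (reflexive to ⊑-reflexive; trans to ⊑-trans)
  open HTree 1<r r≤n using (level; level<r; level-injective)

  σ-reflects : ∀ {a b} → (σ ⟨$⟩ʳ a) ⊑ (σ ⟨$⟩ʳ b) → FinPoset._≤_ (H n r) a b
  σ-reflects {a} {b} σa⊑σb with a F.≟ b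
  ... | yes a≡b = inj₁ a≡b
  ... | no a≢b  = inj₂ (m∸n<m∸o⇒o<n (subst₂ _<_ (depth-σ b) (depth-σ a)
                                       (depth-antitone (σa⊑σb , a≢b ∘ permutation-injective σ))))

  parent : ∀ a → suc (level a) < r → Σ[ j ∈ Fin n ] Covers P (σ ⟨$⟩ʳ a) (σ ⟨$⟩ʳ j) × level j ≡ suc (level a)
  parent a 1+a<r with FP.any? ((σ ⟨$⟩ʳ a) ⊏?_)
  ... | no ∄above = ⊥-elim (ℕP.<⇒≢ 2≤depth (sym (depth-maximal (λ z σa⊏z → ∄above (z , σa⊏z)))))
    where
    2≤depth : 2 ≤ depth (σ ⟨$⟩ʳ a)
    2≤depth = subst (2 ≤_) (sym (depth-σ a)) (ℕP.m+n≤o⇒m≤o∸n 2 1+a<r)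
  ... | yes (_ , σa⊏z) =
    let (p , σa⋖p , _) = cover-below σa⊏z
        j = σ ⟨$⟩ˡ p
        σa⋖σj = subst (Covers P (σ ⟨$⟩ʳ a)) (sym (Perm.inverseʳ σ)) σa⋖p
        depth-step = trans (sym (depth-σ a)) (trans (depth-cover forest σa⋖σj) (cong suc (depth-σ j)))
    in j , σa⋖σj , m∸n≡1+[m∸o]⇒o≡1+n (level<r a) (ℕP.<⇒≤ (level<r j)) depth-step

  ascend : ∀ k a b → k + suc (level a) ≡ level b → (σ ⟨$⟩ʳ a) ⊑ (σ ⟨$⟩ʳ b)
  ascend k a b eq = ⊑-trans (proj₁ (proj₁ σa⋖σj)) (from-parent k eq)
    where
    1+a<r : suc (level a) < r
    1+a<r = ℕP.≤-<-trans (ℕP.m≤n+m (suc (level a)) k) (subst (_< r) (sym eq) (level<r b))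
    next = parent a 1+a<r
    j = proj₁ next
    σa⋖σj = proj₁ (proj₂ next)
    level-j = proj₂ (proj₂ next)
    from-parent : ∀ k′ → k′ + suc (level a) ≡ level b → (σ ⟨$⟩ʳ j) ⊑ (σ ⟨$⟩ʳ b)
    from-parent zero     eq′ = ⊑-reflexive (cong (σ ⟨$⟩ʳ_)
                                 (level-injective (trans level-j eq′) (subst (0 <_) (sym level-j) ℕP.0<1+n)))
    from-parent (suc k′) eq′ = ascend k′ j b (trans (cong (λ m → k′ + suc m) level-j) (trans (ℕP.+-suc k′ _) eq′))

  σ-monotone : ∀ {a b} → FinPoset._≤_ (H n r) a b → (σ ⟨$⟩ʳ a) ⊑ (σ ⟨$⟩ʳ b)
  σ-monotone (inj₁ refl)        = ⊑-refl
  σ-monotone {a} {b} (inj₂ a<b) = ascend (level b ∸ suc (level a)) a b (ℕP.m∸n+n≡m a<b)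

  P≅H : P ≅ H n r
  P≅H = ≅-fromPermutation {P = P} {Q = H n r} σ σ-monotone σ-reflects

lemma5p2 : (n r : ℕ) → 2 ≤ n → 1 < r → r ≤ n →
    (IsTree (H n r) × HasRank (H n r) r)
    × ((P : FinPoset n) → IsTree P → HasRank P r →
        hookSum P ≤ hookSum (H n r)
        × (hookSum P ≡ hookSum (H n r) → P ≅ H n r)
        × (hookSum P + (n ∸ r + 1) C 2 ≤ sumTo n))
    × (hookSum (H n r) + (n ∸ r + 1) C 2 ≡ sumTo n)
-- 2 ≤ n already follows from 1 < r ≤ n.
lemma5p2 n r _ 1<r r≤n =
  (H-isTree , H-rank) ,
  (λ P tree rank →
    let forest = proj₁ tree
        open Comparison r≤n P forest rank
        P≤H = subst (hookSum P ≤_) (sym hookSum-H) hookSum≤∑depthH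
    in P≤H ,
       (λ P≡H → Rigidity.P≅H 1<r r≤n P forest σ (depth-σ≡ (trans P≡H hookSum-H))) ,
       ℕP.≤-trans (ℕP.+-monoˡ-≤ _ P≤H) (ℕP.≤-reflexive H-formula)) ,
  H-formula
  where
  open HTree 1<r r≤n using (H-isTree; H-rank; hookSum-H)
  H-formula : hookSum (H n r) + (n ∸ r + 1) C 2 ≡ sumTo n
  H-formula = trans (cong (_+ (n ∸ r + 1) C 2) hookSum-H) (∑-depthH+binomial (ℕP.≤⇒≤′ r≤n))
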